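{- Let $I_{MR}$ be an instance of MIN-REP with inputs $G=(X,Y,E)$, $\mathcal{P}_X$, $\mathcal{P}_Y$, let $I_D$ be the instance of the 1-DR-2 problem whose input graph is the graph $G'$ constructed from it as described in the context, and let $H$ be the set of the four hubs of $G'$. Then $I_D$ has an optimal solution $D^*$ such that $D^*\setminus H$ is a feasible solution of $I_{MR}$.
   Context: MIN-REP problem: input a bipartite graph $G=(X,Y,E)$, a partition $\mathcal{P}_X=\{X_1,\dots,X_{k_X}\}$ of $X$ into sets of size $|X|/k_X$, and a partition $\mathcal{P}_Y=\{Y_1,\dots,Y_{k_Y}\}$ of $Y$ into sets of size $|Y|/k_Y$. $X_i$ and $Y_j$ form a super edge if some vertex of $X_i$ is adjacent in $G$ to some vertex of $Y_j$. A feasible solution is a set $S\subseteq X\cup Y$ such that for every super edge $(X_i,Y_j)$ there are $x\in S\cap X_i$ and $y\in S\cap Y_j$ with $(x,y)\in E$; the goal is to minimize $|S|$. Construction of $G'$: start with $G$. For each $X_i$ add two vertices $px^1_i,px^2_i$ and edges $(x,px^1_i),(x,px^2_i)$ for every $x\in X_i$; for each $Y_j$ add two vertices $py^1_j,py^2_j$ and edges $(y,py^1_j),(y,py^2_j)$ for every $y\in Y_j$. For each super edge $(X_i,Y_j)$ add two vertices (relays) $r^1_{i,j},r^2_{i,j}$ and edges $(px^1_i,r^1_{i,j}),(r^1_{i,j},py^1_j),(px^2_i,r^2_{i,j}),(r^2_{i,j},py^2_j)$. Let $PX$ be the set of all $px^I_i$, $PY$ the set of all $py^I_j$, $R$ the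 set of relays. Add four hubs $h_{X,R},h_{Y,R},h_{PX},h_{PY}$ (the set $H$): $h_{X,R}$ is adjacent to every vertex of $X\cup R$, $h_{Y,R}$ to every vertex of $Y\cup R$, $h_{PX}$ to every vertex of $PX$, $h_{PY}$ to every vertex of $PY$, and the hubs form the 4-cycle $(h_{PX},h_{Y,R},h_{PY},h_{X,R},h_{PX})$. Finally, for each hub $h$ add two new vertices (dummy nodes) $d_1,d_2$ and edges $(h,d_1),(h,d_2)$. 1-DR-2 problem: for vertices $u,v$ of a graph $G'$, $m_{G'}(u,v)$ is the number of internal vertices on a shortest $u$–$v$ path ($\infty$ if none); for $D\subseteq V(G')$, $m^D(u,v)=m_{G'[D\cup\{u,v\}]}(u,v)$. Vertices $u,v$ form a target couple if $m_{G'}(u,v)=1$; $D$ covers it if $m^D(u,v)\le 2$. A feasible solution is a dominating set $D$ of $G'$ covering all target couples; an optimal solution is a feasible solution of minimum cardinality. -}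

module Defs where

open import Data.Nat using (ℕ; zero; suc; _≤_)
open import Data.Fin using (Fin)
open import Data.Bool using (Bool; T)
open import Data.List using (List; allFin; length)
open import Data.Bool.ListAction using (any)
open import Data.List.Membership.Propositional using (_∈_; _∉_)
open import Data.List.Relation.Unary.Unique.Propositional using (Unique)
open import Data.Product using (Σ; ∃; ∃-syntax; _×_; _,_)
open import Data.Sum using (_⊎_)
open import Data.Unit using (⊤)
open import Relation.Binary.PropositionalEquality using (_≡_)
open import Relation.Nullary using (¬_)

module GraphNotions {V : Set} (Adj : V → V → Set) where

  data Walk (P : V → Set) : V → V → ℕ → Set where
    edge : ∀ {u v} → Adj u v → Walk P u v 1
    step : ∀ {u w v n} → Adj u w → P w → Walk P w v n → Walk P u v (suc n)

  -- "m(u,v) ≤ k" in the subgraph induced by the vertices satisfying P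
  -- (together with u and v): the number of internal vertices of a
  -- shortest u–v path is at most k (u = v gives 0 internal vertices).
  MLe : (P : V → Set) → V → V → ℕ → Set
  MLe P u v k = (u ≡ v) ⊎ (∃[ n ] (n ≤ suc k × Walk P u v n))

  TargetCouple : V → V → Set
  TargetCouple u v = MLe (λ _ → ⊤) u v 1 × ¬ MLe (λ _ → ⊤) u v 0

  InInduced : List V → V → V → V → Set
  InInduced D u v w = (w ∈ D) ⊎ (w ≡ u) ⊎ (w ≡ v)

  Covers : List V → V → V → Set
  Covers D u v = MLe (InInduced D u v) u v 2

  Dominating : List V → Set
  Dominating D = ∀ v → (v ∈ D) ⊎ (∃[ u ] (u ∈ D × Adj u v))

  -- sets of vertices are duplicate-free lists; |D| = length D
  Feasible : List V → Set
  Feasible D = Unique D × Dominating D × (∀ u v → TargetCouple u v → Covers D u v)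

  Optimal : List V → Set
  Optimal D = Feasible D × (∀ D' → Feasible D' → length D ≤ length D')

-- MIN-REP instance and the construction of G'
-- X = Fin kX × Fin sX, the block X_i being {(i,t) | t : Fin sX}
-- (a partition of X into kX sets of equal size sX = |X|/kX); same for Y.

module Construction (kX sX kY sY : ℕ)
                    (E : Fin kX → Fin sX → Fin kY → Fin sY → Bool) where

  superEdge : Fin kX → Fin kY → Bool
  superEdge i j = any (λ t → any (λ s → E i t j s) (allFin sY)) (allFin sX)

  data VG : Set where
    gx : Fin kX → Fin sX → VG
    gy : Fin kY → Fin sY → VG

  MinRepFeasible : (VG → Set) → Set
  MinRepFeasible S = ∀ i j → T (superEdge i j) →
    ∃[ t ] ∃[ s ] (S (gx i t) × S (gy j s) × T (E i t j s))

  data Hub : Set where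
    hXR hYR hPX hPY : Hub

  -- vertices of G'  (the index of type Fin 2 is the superscript I ∈ {1,2})
  data V' : Set where
    vx  : Fin kX → Fin sX → V'
    vy  : Fin kY → Fin sY → V'
    px  : Fin 2 → Fin kX → V'
    py  : Fin 2 → Fin kY → V'
    rel : Fin 2 → (i : Fin kX) → (j : Fin kY) → T (superEdge i j) → V'
    hub : Hub → V'
    dum : Hub → Fin 2 → V'

  embed : VG → V'
  embed (gx i t) = vx i t
  embed (gy j s) = vy j s

  data E' : V' → V' → Set where
    e-xy    : ∀ {i t j s} → T (E i t j s) → E' (vx i t) (vy j s)
    e-xpx   : ∀ {i t I} → E' (vx i t) (px I i)
    e-ypy   : ∀ {j s I} → E' (vy j s) (py I j)
    e-pxr   : ∀ {I i j p} → E' (px I i) (rel I i j p)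
    e-rpy   : ∀ {I i j p} → E' (rel I i j p) (py I j)
    e-hXR-x : ∀ {i t} → E' (hub hXR) (vx i t)
    e-hXR-r : ∀ {I i j p} → E' (hub hXR) (rel I i j p)
    e-hYR-y : ∀ {j s} → E' (hub hYR) (vy j s)
    e-hYR-r : ∀ {I i j p} → E' (hub hYR) (rel I i j p)
    e-hPX   : ∀ {I i} → E' (hub hPX) (px I i)
    e-hPY   : ∀ {I j} → E' (hub hPY) (py I j)
    e-c1    : E' (hub hPX) (hub hYR)
    e-c2    : E' (hub hYR) (hub hPY)
    e-c3    : E' (hub hPY) (hub hXR)
    e-c4    : E' (hub hXR) (hub hPX)
    e-dum   : ∀ {h a} → E' (hub h) (dum h a)

  Adj' : V' → V' → Set
  Adj' u v = E' u v ⊎ E' v u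

  IsHub : V' → Set
  IsHub v = ∃[ h ] (v ≡ hub h)

  open GraphNotions Adj' public

  MinusHubsFeasible : List V' → Set
  MinusHubsFeasible D =
    (∀ v → v ∈ D → ¬ IsHub v → ∃[ w ] (v ≡ embed w))
    × MinRepFeasible (λ w → embed w ∈ D)

module Submission where

-- Write S* for a minimum feasible MIN-REP solution and H for the
-- four hubs.  We show that D* = H ∪ S* is an optimal 1-DR-2 solution of G'; since
-- D* \ H = S*, this proves the theorem.
--
--  * A minimum MIN-REP solution exists and can be taken duplicate-free: the problem
--    is finite and feasibility is decidable and monotone, so the shortest feasible
--    sublist of an enumeration of X ∪ Y is minimum (module MinimumSubset).
--  * Upper bound: H ∪ S is feasible for every feasible S.  The hubs dominate G',
--    and every target couple is joined by a path through at most two hubs, except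
--    the couples (px^I_i, py^I_j) joined through a relay, which S covers through an
--    edge x–y of the super edge (X_i, Y_j) (module HubsAndRepresentatives).
--  * Lower bound: every feasible D contains the four hubs (forced by the dummy
--    couples), and replacing each relay r^1_{ij} (resp. r^2_{ij}) of D by a fixed
--    endpoint in X_i (resp. Y_j) of an edge of the super edge, keeping the vertices
--    of X ∪ Y and dropping the rest, yields a feasible MIN-REP solution of size at
--    most |D| - 4 (module LowerBound).
--  Hence |D*| = 4 + |S*| ≤ |D| for every feasible D.

open import Defs
open import Data.Nat using (ℕ; suc; _≤_; _+_; z≤n; s≤s)
open import Data.Nat.Properties
  using (≤-refl; +-mono-≤; +-monoʳ-≤; +-comm; +-commutativeSemigroup; module ≤-Reasoning)
open import Algebra.Properties.CommutativeSemigroup +-commutativeSemigroup using (interchange)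
open import Data.Fin using (Fin) renaming (zero to 0F; suc to sucF)
import Data.Fin.Properties as Fin
open import Data.Bool using (Bool; true; false; T)
open import Data.Bool.Properties using (T-irrelevant)
open import Data.List
  using (List; []; _∷_; [_]; _++_; map; length; filter; concatMap; allFin; cartesianProduct; deduplicate)
open import Data.List.Properties using (length-++; length-map; length-removeAt′)
open import Data.List.Membership.Propositional using (_∈_; _─_; lose)
open import Data.List.Membership.Propositional.Properties
  using (∈-++⁺ˡ; ∈-++⁺ʳ; ∈-++⁻; ∈-map⁺; ∈-map⁻; ∈-filter⁺; ∈-filter⁻; ∈-allFin;
         ∈-cartesianProduct⁺; ∈-deduplicate⁺; ∈-concatMap⁺)
import Data.List.Membership.DecPropositional as DecMembership
open import Data.List.Relation.Binary.Subset.Propositional using (_⊆_)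
open import Data.List.Relation.Unary.Any using (here; there; index; satisfied)
open import Data.List.Relation.Unary.Any.Properties using (any⁻)
open import Data.List.Relation.Unary.All using ([]; _∷_; lookup)
open import Data.List.Relation.Unary.All.Properties using (all-filter)
open import Data.List.Relation.Unary.AllPairs using ([]; _∷_)
open import Data.List.Relation.Unary.Unique.Propositional using (Unique)
import Data.List.Relation.Unary.Unique.Propositional.Properties as Unique
import Data.List.Relation.Unary.Unique.DecPropositional.Properties as DecUnique
open import Data.List.Extrema.Nat using (argmin; argmin-all; f[argmin]≤f[xs])
open import Data.Product using (∃-syntax; _×_; _,_; proj₁; proj₂; uncurry)
open import Data.Sum using (_⊎_; inj₁; inj₂)
open import Data.Empty using (⊥; ⊥-elim)
open import Data.Unit using (⊤; tt)
open import Relation.Binary.PropositionalEquality using (_≡_; _≢_; refl; sym; cong; cong₂; subst)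
open import Relation.Binary.Definitions using (DecidableEquality)
open import Relation.Nullary using (¬_; no; does)
open import Relation.Nullary.Decidable using (T?; map′; _×-dec_; _→-dec_)
open import Relation.Unary using (Decidable)

module _ {A : Set} where

  ∈-─ : ∀ {x y : A} {ys} (x∈ys : x ∈ ys) → y ∈ ys → y ≢ x → y ∈ ys ─ x∈ys
  ∈-─ (here refl) (here refl) y≢x = ⊥-elim (y≢x refl)
  ∈-─ (here _)    (there y∈ys) _  = y∈ys
  ∈-─ (there _)   (here y≡z)   _  = here y≡z
  ∈-─ (there x∈ys) (there y∈ys) y≢x = there (∈-─ x∈ys y∈ys y≢x)

  unique⊆⇒length≤ : ∀ {xs ys : List A} → Unique xs → xs ⊆ ys → length xs ≤ length ys
  unique⊆⇒length≤ {[]} _ _ = z≤n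
  unique⊆⇒length≤ {x ∷ xs} {ys} (x∉xs ∷ xs!) xs⊆ys = begin
    suc (length xs)          ≤⟨ s≤s (unique⊆⇒length≤ xs! xs⊆ys─x) ⟩
    suc (length (ys ─ x∈ys)) ≡⟨ sym (length-removeAt′ ys (index x∈ys)) ⟩
    length ys                ∎
    where
    open ≤-Reasoning
    x∈ys : x ∈ ys
    x∈ys = xs⊆ys (here refl)
    xs⊆ys─x : xs ⊆ ys ─ x∈ys
    xs⊆ys─x z∈xs = ∈-─ x∈ys (xs⊆ys (there z∈xs)) λ { refl → lookup x∉xs z∈xs refl }

  length-concatMap₂ : ∀ {B C : Set} (f : A → List B) (g : A → List C) →
                      (∀ x → length (f x) + length (g x) ≤ 1) →
                      ∀ xs → length (concatMap f xs) + length (concatMap g xs) ≤ length xs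
  length-concatMap₂ f g _ [] = z≤n
  length-concatMap₂ f g atMostOne (x ∷ xs) = begin
    length (f x ++ F) + length (g x ++ G)           ≡⟨ cong₂ _+_ (length-++ (f x)) (length-++ (g x)) ⟩
    (length (f x) + length F) + (length (g x) + length G)
                                                    ≡⟨ interchange (length (f x)) (length F) (length (g x)) (length G) ⟩
    (length (f x) + length (g x)) + (length F + length G)
                                                    ≤⟨ +-mono-≤ (atMostOne x) (length-concatMap₂ f g atMostOne xs) ⟩
    suc (length xs)                                 ∎
    where
    open ≤-Reasoning
    F = concatMap f xs
    G = concatMap g xs

  sublists : List A → List (List A)
  sublists []       = [ [] ]
  sublists (x ∷ xs) = map (x ∷_) (sublists xs) ++ sublists xs

  filter∈sublists : ∀ {P : A → Set} (P? : Decidable P) xs → filter P? xs ∈ sublists xs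
  filter∈sublists P? [] = here refl
  filter∈sublists P? (x ∷ xs) with does (P? x)
  ... | true  = ∈-++⁺ˡ (∈-map⁺ (x ∷_) (filter∈sublists P? xs))
  ... | false = ∈-++⁺ʳ (map (x ∷_) (sublists xs)) (filter∈sublists P? xs)

module MinimumSubset {A : Set} (_≟_ : DecidableEquality A)
                     (enum : List A) (complete : ∀ x → x ∈ enum)
                     {P : List A → Set} (P? : Decidable P)
                     (P-mono : ∀ {S S′} → S ⊆ S′ → P S → P S′) where

  open DecMembership _≟_ using (_∈?_)

  universe : List A
  universe = deduplicate _≟_ enum

  canon : List A → List A
  canon S = filter (_∈? S) universe

  canon-unique : ∀ S → Unique (canon S)
  canon-unique S = Unique.filter⁺ (_∈? S) (DecUnique.deduplicate-! _≟_ enum)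

  ⊆-canon : ∀ {S} → S ⊆ canon S
  ⊆-canon {S} {x} x∈S = ∈-filter⁺ (_∈? S) (∈-deduplicate⁺ _≟_ (complete x)) x∈S

  canon-length : ∀ S → length (canon S) ≤ length S
  canon-length S = unique⊆⇒length≤ (canon-unique S) (λ x∈ → proj₂ (∈-filter⁻ (_∈? S) {xs = universe} x∈))

  minimum : ∀ S₀ → P S₀ → ∃[ S ] (Unique S × P S × ∀ S′ → P S′ → length S ≤ length S′)
  minimum S₀ pS₀ = canon M , canon-unique M , P-mono ⊆-canon pM , M-minimum
    where
    candidates : List (List A)
    candidates = filter P? (sublists universe)

    M : List A
    M = argmin length (canon S₀) candidates

    pM : P M
    pM = argmin-all length (P-mono ⊆-canon pS₀) (all-filter P? (sublists universe))

    M-minimum : ∀ S′ → P S′ → length (canon M) ≤ length S′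
    M-minimum S′ pS′ = begin
      length (canon M)  ≤⟨ canon-length M ⟩
      length M          ≤⟨ lookup (f[argmin]≤f[xs] {f = length} (canon S₀) candidates) canon-S′∈candidates ⟩
      length (canon S′) ≤⟨ canon-length S′ ⟩
      length S′         ∎
      where
      open ≤-Reasoning
      canon-S′∈candidates : canon S′ ∈ candidates
      canon-S′∈candidates = ∈-filter⁺ P? (filter∈sublists (_∈? S′) universe) (P-mono ⊆-canon pS′)

module ShortWalks {V : Set} (Adj : V → V → Set) where
  open GraphNotions Adj

  walk-mono : ∀ {P Q : V → Set} → (∀ {w} → P w → Q w) → ∀ {u v n} → Walk P u v n → Walk Q u v n
  walk-mono P⇒Q (edge e)     = edge e
  walk-mono P⇒Q (step e p w) = step e (P⇒Q p) (walk-mono P⇒Q w)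

  covered-by : ∀ {D u v n} → Walk (_∈ D) u v n → n ≤ 3 → Covers D u v
  covered-by w n≤3 = inj₂ (_ , n≤3 , walk-mono inj₁ w)

  inner-in : ∀ {D u v w} → InInduced D u v w → w ≢ u → w ≢ v → w ∈ D
  inner-in (inj₁ w∈D)        _   _   = w∈D
  inner-in (inj₂ (inj₁ w≡u)) w≢u _   = ⊥-elim (w≢u w≡u)
  inner-in (inj₂ (inj₂ w≡v)) _   w≢v = ⊥-elim (w≢v w≡v)

  target-couple : ∀ {u w v} → Adj u w → Adj w v → u ≢ v → ¬ Adj u v → TargetCouple u v
  target-couple e₁ e₂ u≢v u≁v = inj₂ (2 , ≤-refl , step e₁ tt (edge e₂)) , not-closer
    where
    not-closer : ¬ MLe (λ _ → ⊤) _ _ 0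
    not-closer (inj₁ u≡v)                     = u≢v u≡v
    not-closer (inj₂ (_ , _ , edge e))        = u≁v e
    not-closer (inj₂ (_ , s≤s () , step _ _ (edge _)))
    not-closer (inj₂ (_ , s≤s () , step _ _ (step _ _ _)))

module Reduction (kX sX kY sY : ℕ) (E : Fin kX → Fin sX → Fin kY → Fin sY → Bool) where
  open Construction kX sX kY sY E
  open ShortWalks Adj'

  MinRep : List VG → Set
  MinRep S = MinRepFeasible (_∈ S)

  super-edge-witness : ∀ {i j} → T (superEdge i j) → ∃[ t ] ∃[ s ] T (E i t j s)
  super-edge-witness q =
    let t , q′ = satisfied (any⁻ _ (allFin sX) q)
        s , e  = satisfied (any⁻ _ (allFin sY) q′)
    in t , s , e

  _≟VG_ : DecidableEquality VG
  gx i t ≟VG gx i′ t′ = map′ (λ { (refl , refl) → refl }) (λ { refl → refl , refl }) ((i Fin.≟ i′) ×-dec (t Fin.≟ t′))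
  gy j s ≟VG gy j′ s′ = map′ (λ { (refl , refl) → refl }) (λ { refl → refl , refl }) ((j Fin.≟ j′) ×-dec (s Fin.≟ s′))
  gx _ _ ≟VG gy _ _ = no λ ()
  gy _ _ ≟VG gx _ _ = no λ ()

  allVG : List VG
  allVG = map (uncurry gx) (cartesianProduct (allFin kX) (allFin sX))
       ++ map (uncurry gy) (cartesianProduct (allFin kY) (allFin sY))

  allVG-complete : ∀ v → v ∈ allVG
  allVG-complete (gx i t) = ∈-++⁺ˡ (∈-map⁺ (uncurry gx) (∈-cartesianProduct⁺ (∈-allFin i) (∈-allFin t)))
  allVG-complete (gy j s) = ∈-++⁺ʳ _ (∈-map⁺ (uncurry gy) (∈-cartesianProduct⁺ (∈-allFin j) (∈-allFin s)))

  open DecMembership _≟VG_ using (_∈?_)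

  minRep? : Decidable MinRep
  minRep? S = Fin.all? λ i → Fin.all? λ j → T? (superEdge i j) →-dec
    Fin.any? λ t → Fin.any? λ s → (gx i t ∈? S) ×-dec (gy j s ∈? S) ×-dec T? (E i t j s)

  minRep-mono : ∀ {P Q : VG → Set} → (∀ {v} → P v → Q v) → MinRepFeasible P → MinRepFeasible Q
  minRep-mono P⇒Q feasible i j q =
    let t , s , x∈P , y∈P , e = feasible i j q in t , s , P⇒Q x∈P , P⇒Q y∈P , e

  minRep-allVG : MinRep allVG
  minRep-allVG i j q = let t , s , e = super-edge-witness q in
    t , s , allVG-complete (gx i t) , allVG-complete (gy j s) , e

  minimum-minRep : ∃[ S ] (Unique S × MinRep S × ∀ S′ → MinRep S′ → length S ≤ length S′)
  minimum-minRep =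
    MinimumSubset.minimum _≟VG_ allVG allVG-complete minRep? (λ S⊆S′ → minRep-mono λ {v} → S⊆S′ {v})
      allVG minRep-allVG

  allHubs : List Hub
  allHubs = hXR ∷ hYR ∷ hPX ∷ hPY ∷ []

  allHubs-complete : ∀ h → h ∈ allHubs
  allHubs-complete hXR = here refl
  allHubs-complete hYR = there (here refl)
  allHubs-complete hPX = there (there (here refl))
  allHubs-complete hPY = there (there (there (here refl)))

  allHubs-unique : Unique allHubs
  allHubs-unique = ((λ ()) ∷ (λ ()) ∷ (λ ()) ∷ []) ∷ ((λ ()) ∷ (λ ()) ∷ []) ∷ ((λ ()) ∷ []) ∷ [] ∷ []

  embed-injective : ∀ {v w} → embed v ≡ embed w → v ≡ w
  embed-injective {gx _ _} {gx _ _} refl = refl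
  embed-injective {gy _ _} {gy _ _} refl = refl

  hub≢embed : ∀ {h} v → hub h ≢ embed v
  hub≢embed (gx _ _) ()
  hub≢embed (gy _ _) ()

  dummy-couple : ∀ h → TargetCouple (dum h 0F) (dum h (sucF 0F))
  dummy-couple h = target-couple (inj₂ e-dum) (inj₁ e-dum) (λ ()) λ { (inj₁ ()) ; (inj₂ ()) }

  relay-couple : ∀ I {i j} → T (superEdge i j) → TargetCouple (px I i) (py I j)
  relay-couple I q = target-couple (inj₁ (e-pxr {p = q})) (inj₁ e-rpy) (λ ()) λ { (inj₁ ()) ; (inj₂ ()) }

  module HubsAndRepresentatives (S : List VG) (S-feasible : MinRep S) where

    D : List V'
    D = map hub allHubs ++ map embed S

    hub∈D : ∀ h → hub h ∈ D
    hub∈D h = ∈-++⁺ˡ (∈-map⁺ hub (allHubs-complete h))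

    embed∈D : ∀ {v} → v ∈ S → embed v ∈ D
    embed∈D v∈S = ∈-++⁺ʳ _ (∈-map⁺ embed v∈S)

    D-length : length D ≡ 4 + length S
    D-length = cong (4 +_) (length-map embed S)

    D-unique : Unique S → Unique D
    D-unique S! = Unique.++⁺ (Unique.map⁺ {f = hub} (λ { refl → refl }) allHubs-unique)
                             (Unique.map⁺ embed-injective S!) disjoint
      where
      disjoint : ∀ {v} → ¬ (v ∈ map hub allHubs × v ∈ map embed S)
      disjoint (v∈H , v∈S) with ∈-map⁻ hub v∈H | ∈-map⁻ embed v∈S
      ... | _ , _ , refl | w , _ , eq = hub≢embed w eq

    dominating : Dominating D
    dominating (vx _ _)      = inj₂ (hub hXR , hub∈D hXR , inj₁ e-hXR-x)
    dominating (vy _ _)      = inj₂ (hub hYR , hub∈D hYR , inj₁ e-hYR-y)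
    dominating (px _ _)      = inj₂ (hub hPX , hub∈D hPX , inj₁ e-hPX)
    dominating (py _ _)      = inj₂ (hub hPY , hub∈D hPY , inj₁ e-hPY)
    dominating (rel _ _ _ _) = inj₂ (hub hXR , hub∈D hXR , inj₁ e-hXR-r)
    dominating (hub h)       = inj₁ (hub∈D h)
    dominating (dum h _)     = inj₂ (hub h , hub∈D h , inj₁ e-dum)

    via : ∀ {u v} h → Adj' u (hub h) → Adj' (hub h) v → Covers D u v
    via h e₁ e₂ = covered-by (step e₁ (hub∈D h) (edge e₂)) (s≤s (s≤s z≤n))

    via₂ : ∀ {u v} h h′ → Adj' u (hub h) → Adj' (hub h) (hub h′) → Adj' (hub h′) v → Covers D u v
    via₂ h h′ e₁ e₂ e₃ = covered-by (step e₁ (hub∈D h) (step e₂ (hub∈D h′) (edge e₃))) ≤-refl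

    through-X : ∀ {u v i t} → Adj' u (vx i t) → Adj' (vx i t) v → Covers D u v
    through-X (inj₁ e-hXR-x)  (inj₁ (e-xy _)) = via₂ hPY hYR (inj₂ e-c3) (inj₂ e-c2) (inj₁ e-hYR-y)
    through-X (inj₁ e-hXR-x)  (inj₁ e-xpx)    = via hPX (inj₁ e-c4) (inj₁ e-hPX)
    through-X (inj₁ e-hXR-x)  (inj₂ e-hXR-x)  = inj₁ refl
    through-X (inj₂ (e-xy _)) (inj₁ (e-xy _)) = via hYR (inj₂ e-hYR-y) (inj₁ e-hYR-y)
    through-X (inj₂ (e-xy _)) (inj₁ e-xpx)    = via₂ hYR hPX (inj₂ e-hYR-y) (inj₂ e-c1) (inj₁ e-hPX)
    through-X (inj₂ (e-xy _)) (inj₂ e-hXR-x)  = via₂ hYR hPY (inj₂ e-hYR-y) (inj₁ e-c2) (inj₁ e-c3)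
    through-X (inj₂ e-xpx)    (inj₁ (e-xy _)) = via₂ hPX hYR (inj₂ e-hPX) (inj₁ e-c1) (inj₁ e-hYR-y)
    through-X (inj₂ e-xpx)    (inj₁ e-xpx)    = via hPX (inj₂ e-hPX) (inj₁ e-hPX)
    through-X (inj₂ e-xpx)    (inj₂ e-hXR-x)  = via hPX (inj₂ e-hPX) (inj₂ e-c4)

    through-Y : ∀ {u v j s} → Adj' u (vy j s) → Adj' (vy j s) v → Covers D u v
    through-Y (inj₁ (e-xy _)) (inj₂ (e-xy _)) = via hXR (inj₂ e-hXR-x) (inj₁ e-hXR-x)
    through-Y (inj₁ (e-xy _)) (inj₁ e-ypy)    = via₂ hXR hPY (inj₂ e-hXR-x) (inj₂ e-c3) (inj₁ e-hPY)
    through-Y (inj₁ (e-xy _)) (inj₂ e-hYR-y)  = via₂ hXR hPY (inj₂ e-hXR-x) (inj₂ e-c3) (inj₂ e-c2)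
    through-Y (inj₁ e-hYR-y)  (inj₂ (e-xy _)) = via₂ hPY hXR (inj₁ e-c2) (inj₁ e-c3) (inj₁ e-hXR-x)
    through-Y (inj₁ e-hYR-y)  (inj₁ e-ypy)    = via hPY (inj₁ e-c2) (inj₁ e-hPY)
    through-Y (inj₁ e-hYR-y)  (inj₂ e-hYR-y)  = inj₁ refl
    through-Y (inj₂ e-ypy)    (inj₂ (e-xy _)) = via₂ hPY hXR (inj₂ e-hPY) (inj₁ e-c3) (inj₁ e-hXR-x)
    through-Y (inj₂ e-ypy)    (inj₁ e-ypy)    = via hPY (inj₂ e-hPY) (inj₁ e-hPY)
    through-Y (inj₂ e-ypy)    (inj₂ e-hYR-y)  = via hPY (inj₂ e-hPY) (inj₂ e-c2)

    through-PX : ∀ {u v I i} → Adj' u (px I i) → Adj' (px I i) v → Covers D u v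
    through-PX (inj₁ e-xpx) (inj₂ e-xpx) = via hXR (inj₂ e-hXR-x) (inj₁ e-hXR-x)
    through-PX (inj₁ e-xpx) (inj₁ e-pxr) = via hXR (inj₂ e-hXR-x) (inj₁ e-hXR-r)
    through-PX (inj₁ e-xpx) (inj₂ e-hPX) = via hXR (inj₂ e-hXR-x) (inj₁ e-c4)
    through-PX (inj₂ e-pxr) (inj₂ e-xpx) = via hXR (inj₂ e-hXR-r) (inj₁ e-hXR-x)
    through-PX (inj₂ e-pxr) (inj₁ e-pxr) = via hXR (inj₂ e-hXR-r) (inj₁ e-hXR-r)
    through-PX (inj₂ e-pxr) (inj₂ e-hPX) = via hXR (inj₂ e-hXR-r) (inj₁ e-c4)
    through-PX (inj₁ e-hPX) (inj₂ e-xpx) = via hXR (inj₂ e-c4) (inj₁ e-hXR-x)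
    through-PX (inj₁ e-hPX) (inj₁ e-pxr) = via hXR (inj₂ e-c4) (inj₁ e-hXR-r)
    through-PX (inj₁ e-hPX) (inj₂ e-hPX) = inj₁ refl

    through-PY : ∀ {u v I j} → Adj' u (py I j) → Adj' (py I j) v → Covers D u v
    through-PY (inj₁ e-ypy) (inj₂ e-ypy) = via hYR (inj₂ e-hYR-y) (inj₁ e-hYR-y)
    through-PY (inj₁ e-ypy) (inj₂ e-rpy) = via hYR (inj₂ e-hYR-y) (inj₁ e-hYR-r)
    through-PY (inj₁ e-ypy) (inj₂ e-hPY) = via hYR (inj₂ e-hYR-y) (inj₁ e-c2)
    through-PY (inj₁ e-rpy) (inj₂ e-ypy) = via hYR (inj₂ e-hYR-r) (inj₁ e-hYR-y)
    through-PY (inj₁ e-rpy) (inj₂ e-rpy) = via hYR (inj₂ e-hYR-r) (inj₁ e-hYR-r)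
    through-PY (inj₁ e-rpy) (inj₂ e-hPY) = via hYR (inj₂ e-hYR-r) (inj₁ e-c2)
    through-PY (inj₁ e-hPY) (inj₂ e-ypy) = via hYR (inj₂ e-c2) (inj₁ e-hYR-y)
    through-PY (inj₁ e-hPY) (inj₂ e-rpy) = via hYR (inj₂ e-c2) (inj₁ e-hYR-r)
    through-PY (inj₁ e-hPY) (inj₂ e-hPY) = inj₁ refl

    -- The only couples not covered through hubs: px^I_i and py^I_j, joined
    -- through the relay r^I_{ij}, are covered by the path px–x–y–py given by a
    -- representative edge of S for the super edge (X_i, Y_j).
    through-relay : ∀ {u v I i j q} → Adj' u (rel I i j q) → Adj' (rel I i j q) v → Covers D u v
    through-relay (inj₁ (e-pxr {p = q})) (inj₁ e-rpy) =
      let t , s , x∈S , y∈S , e = S-feasible _ _ q in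
      covered-by (step (inj₂ e-xpx) (embed∈D x∈S) (step (inj₁ (e-xy e)) (embed∈D y∈S) (edge (inj₁ e-ypy)))) ≤-refl
    through-relay (inj₂ (e-rpy {p = q})) (inj₂ e-pxr) =
      let t , s , x∈S , y∈S , e = S-feasible _ _ q in
      covered-by (step (inj₂ e-ypy) (embed∈D y∈S) (step (inj₂ (e-xy e)) (embed∈D x∈S) (edge (inj₁ e-xpx)))) ≤-refl
    through-relay (inj₁ e-pxr)   (inj₂ e-pxr)   = inj₁ refl
    through-relay (inj₁ e-pxr)   (inj₂ e-hXR-r) = via hPX (inj₂ e-hPX) (inj₂ e-c4)
    through-relay (inj₁ e-pxr)   (inj₂ e-hYR-r) = via hPX (inj₂ e-hPX) (inj₁ e-c1)
    through-relay (inj₂ e-rpy)   (inj₁ e-rpy)   = inj₁ refl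
    through-relay (inj₂ e-rpy)   (inj₂ e-hXR-r) = via hPY (inj₂ e-hPY) (inj₁ e-c3)
    through-relay (inj₂ e-rpy)   (inj₂ e-hYR-r) = via hPY (inj₂ e-hPY) (inj₂ e-c2)
    through-relay (inj₁ e-hXR-r) (inj₂ e-pxr)   = via hPX (inj₁ e-c4) (inj₁ e-hPX)
    through-relay (inj₁ e-hXR-r) (inj₁ e-rpy)   = via hPY (inj₂ e-c3) (inj₁ e-hPY)
    through-relay (inj₁ e-hXR-r) (inj₂ e-hXR-r) = inj₁ refl
    through-relay (inj₁ e-hXR-r) (inj₂ e-hYR-r) = via hPY (inj₂ e-c3) (inj₂ e-c2)
    through-relay (inj₁ e-hYR-r) (inj₂ e-pxr)   = via hPX (inj₂ e-c1) (inj₁ e-hPX)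
    through-relay (inj₁ e-hYR-r) (inj₁ e-rpy)   = via hPY (inj₁ e-c2) (inj₁ e-hPY)
    through-relay (inj₁ e-hYR-r) (inj₂ e-hXR-r) = via hPY (inj₁ e-c2) (inj₁ e-c3)
    through-relay (inj₁ e-hYR-r) (inj₂ e-hYR-r) = inj₁ refl

    covers-2-walk : ∀ {u w v} → Adj' u w → Adj' w v → Covers D u v
    covers-2-walk {w = vx _ _}      = through-X
    covers-2-walk {w = vy _ _}      = through-Y
    covers-2-walk {w = px _ _}      = through-PX
    covers-2-walk {w = py _ _}      = through-PY
    covers-2-walk {w = rel _ _ _ _} = through-relay
    covers-2-walk {w = hub h}       = via h
    covers-2-walk {w = dum h _} (inj₁ e-dum) (inj₂ e-dum) = inj₁ refl

    covers-targets : ∀ u v → TargetCouple u v → Covers D u v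
    covers-targets u v (inj₁ u≡v , _)                      = inj₁ u≡v
    covers-targets u v (inj₂ (_ , _ , edge e) , _)         = inj₂ (1 , s≤s z≤n , edge e)
    covers-targets u v (inj₂ (_ , _ , step e₁ _ (edge e₂)) , _) = covers-2-walk e₁ e₂
    covers-targets u v (inj₂ (_ , s≤s (s≤s ()) , step _ _ (step _ _ (edge _))) , _)
    covers-targets u v (inj₂ (_ , s≤s (s≤s ()) , step _ _ (step _ _ (step _ _ _))) , _)

    feasible : Unique S → Feasible D
    feasible S! = D-unique S! , dominating , covers-targets

    minus-hubs : MinusHubsFeasible D
    minus-hubs = outside-hubs , minRep-mono (λ {v} → embed∈D {v}) S-feasible
      where
      outside-hubs : ∀ v → v ∈ D → ¬ IsHub v → ∃[ w ] (v ≡ embed w)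
      outside-hubs v v∈D v∉H with ∈-++⁻ (map hub allHubs) v∈D
      ... | inj₁ v∈H with ∈-map⁻ hub v∈H
      ...   | h , _ , v≡h = ⊥-elim (v∉H (h , v≡h))
      outside-hubs v v∈D v∉H | inj₂ v∈S with ∈-map⁻ embed v∈S
      ...   | w , _ , v≡w = w , v≡w

  hub-forced : ∀ {D′ h} → Covers D′ (dum h 0F) (dum h (sucF 0F)) → hub h ∈ D′
  hub-forced (inj₁ ())
  hub-forced (inj₂ (_ , _ , edge (inj₁ ())))
  hub-forced (inj₂ (_ , _ , edge (inj₂ ())))
  hub-forced (inj₂ (_ , _ , step (inj₂ e-dum) h∈ _)) = inner-in h∈ (λ ()) (λ ())

  Represented : List V' → Fin kX → Fin kY → Set
  Represented D′ i j = ∃[ t ] ∃[ s ] (vx i t ∈ D′ × vy j s ∈ D′ × T (E i t j s))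

  PYNeighbour : V' → Set
  PYNeighbour (vy _ _)      = ⊤
  PYNeighbour (rel _ _ _ _) = ⊤
  PYNeighbour (hub hPY)     = ⊤
  PYNeighbour _             = ⊥

  py-neighbour : ∀ {w I j} → Adj' w (py I j) → PYNeighbour w
  py-neighbour (inj₁ e-ypy) = tt
  py-neighbour (inj₁ e-rpy) = tt
  py-neighbour (inj₁ e-hPY) = tt

  -- A set covering (px^I_i, py^I_j) contains the relay r^I_{ij} or represents
  -- (X_i, Y_j): the only short paths are px–r–py and px–x–y–py.
  relay-or-represented : ∀ {D′ I i j} (q : T (superEdge i j)) → Covers D′ (px I i) (py I j) →
                         rel I i j q ∈ D′ ⊎ Represented D′ i j
  relay-or-represented q (inj₁ ())
  relay-or-represented q (inj₂ (_ , _ , edge (inj₁ ())))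
  relay-or-represented q (inj₂ (_ , _ , edge (inj₂ ())))
  relay-or-represented q (inj₂ (_ , _ , step (inj₁ (e-pxr {p = q′})) r∈ (edge (inj₁ e-rpy)))) =
    inj₁ (subst (λ q → rel _ _ _ q ∈ _) (T-irrelevant q′ q) (inner-in r∈ (λ ()) (λ ())))
  relay-or-represented q (inj₂ (_ , _ , step (inj₂ e-xpx) x∈ (step (inj₁ (e-xy e)) y∈ (edge (inj₁ e-ypy))))) =
    inj₂ (_ , _ , inner-in x∈ (λ ()) (λ ()) , inner-in y∈ (λ ()) (λ ()) , e)
  relay-or-represented q (inj₂ (_ , _ , step (inj₁ e-pxr) _ (edge (inj₂ ()))))
  relay-or-represented q (inj₂ (_ , _ , step (inj₂ e-xpx) _ (edge e)))                       = ⊥-elim (py-neighbour e)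
  relay-or-represented q (inj₂ (_ , _ , step (inj₂ e-hPX) _ (edge e)))                       = ⊥-elim (py-neighbour e)
  relay-or-represented q (inj₂ (_ , _ , step (inj₂ e-xpx) _ (step (inj₁ (e-xy _)) _ (edge (inj₂ ())))))
  relay-or-represented q (inj₂ (_ , _ , step (inj₂ e-xpx) _ (step (inj₁ e-xpx) _ (edge e))))   = ⊥-elim (py-neighbour e)
  relay-or-represented q (inj₂ (_ , _ , step (inj₂ e-xpx) _ (step (inj₂ e-hXR-x) _ (edge e)))) = ⊥-elim (py-neighbour e)
  relay-or-represented q (inj₂ (_ , _ , step (inj₁ e-pxr) _ (step (inj₂ e-pxr) _ (edge e))))   = ⊥-elim (py-neighbour e)
  relay-or-represented q (inj₂ (_ , _ , step (inj₁ e-pxr) _ (step (inj₁ e-rpy) _ (edge e))))   = ⊥-elim (py-neighbour e)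
  relay-or-represented q (inj₂ (_ , _ , step (inj₁ e-pxr) _ (step (inj₂ e-hXR-r) _ (edge e)))) = ⊥-elim (py-neighbour e)
  relay-or-represented q (inj₂ (_ , _ , step (inj₁ e-pxr) _ (step (inj₂ e-hYR-r) _ (edge e)))) = ⊥-elim (py-neighbour e)
  relay-or-represented q (inj₂ (_ , _ , step (inj₂ e-hPX) _ (step (inj₁ e-hPX) _ (edge e))))   = ⊥-elim (py-neighbour e)
  relay-or-represented q (inj₂ (_ , _ , step (inj₂ e-hPX) _ (step (inj₁ e-c1) _ (edge e))))    = ⊥-elim (py-neighbour e)
  relay-or-represented q (inj₂ (_ , _ , step (inj₂ e-hPX) _ (step (inj₂ e-c4) _ (edge e))))    = ⊥-elim (py-neighbour e)
  relay-or-represented q (inj₂ (_ , _ , step (inj₂ e-hPX) _ (step (inj₁ e-dum) _ (edge e))))   = ⊥-elim (py-neighbour e)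
  relay-or-represented q (inj₂ (_ , s≤s (s≤s (s≤s ())) , step _ _ (step _ _ (step _ _ (edge _)))))
  relay-or-represented q (inj₂ (_ , s≤s (s≤s (s≤s ())) , step _ _ (step _ _ (step _ _ (step _ _ _)))))

  shadow : V' → List VG
  shadow (vx i t)             = [ gx i t ]
  shadow (vy j s)             = [ gy j s ]
  shadow (rel 0F i j q)       = [ gx i (proj₁ (super-edge-witness q)) ]
  shadow (rel (sucF _) i j q) = [ gy j (proj₁ (proj₂ (super-edge-witness q))) ]
  shadow (px _ _)             = []
  shadow (py _ _)             = []
  shadow (hub _)              = []
  shadow (dum _ _)            = []

  hubs-of : V' → List Hub
  hubs-of (hub h) = [ h ]
  hubs-of _       = []

  shadow-or-hub : ∀ v → length (shadow v) + length (hubs-of v) ≤ 1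
  shadow-or-hub (vx _ _)             = ≤-refl
  shadow-or-hub (vy _ _)             = ≤-refl
  shadow-or-hub (rel 0F _ _ _)       = ≤-refl
  shadow-or-hub (rel (sucF _) _ _ _) = ≤-refl
  shadow-or-hub (px _ _)             = z≤n
  shadow-or-hub (py _ _)             = z≤n
  shadow-or-hub (hub _)              = ≤-refl
  shadow-or-hub (dum _ _)            = z≤n

  module LowerBound (D′ : List V') (D′-feasible : Feasible D′) where

    covers : ∀ u v → TargetCouple u v → Covers D′ u v
    covers = proj₂ (proj₂ D′-feasible)

    S : List VG
    S = concatMap shadow D′

    shadow⊆S : ∀ {v w} → v ∈ D′ → w ∈ shadow v → w ∈ S
    shadow⊆S v∈D′ w∈ = ∈-concatMap⁺ shadow (lose v∈D′ w∈)

    -- D′ covers both couples (px^1_i, py^1_j) and (px^2_i, py^2_j); unless one of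
    -- them is covered through an edge of the super edge, both relays r^1_{ij} and
    -- r^2_{ij} are in D′, and their shadows form the fixed edge of the super edge.
    S-feasible : MinRep S
    S-feasible i j q
      with relay-or-represented q (covers _ _ (relay-couple 0F q))
         | relay-or-represented q (covers _ _ (relay-couple (sucF 0F) q))
    ... | inj₂ (t , s , x∈ , y∈ , e) | _ = t , s , shadow⊆S x∈ (here refl) , shadow⊆S y∈ (here refl) , e
    ... | inj₁ _ | inj₂ (t , s , x∈ , y∈ , e) = t , s , shadow⊆S x∈ (here refl) , shadow⊆S y∈ (here refl) , e
    ... | inj₁ r¹∈ | inj₁ r²∈ =
      let t , s , e = super-edge-witness q in t , s , shadow⊆S r¹∈ (here refl) , shadow⊆S r²∈ (here refl) , e

    four-hubs : 4 ≤ length (concatMap hubs-of D′)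
    four-hubs = unique⊆⇒length≤ allHubs-unique
      λ {h} _ → ∈-concatMap⁺ hubs-of (lose (hub-forced (covers _ _ (dummy-couple h))) (here refl))

    S-small : 4 + length S ≤ length D′
    S-small = begin
      4 + length S                             ≤⟨ +-mono-≤ four-hubs ≤-refl ⟩
      length (concatMap hubs-of D′) + length S ≡⟨ +-comm _ (length S) ⟩
      length S + length (concatMap hubs-of D′) ≤⟨ length-concatMap₂ shadow hubs-of shadow-or-hub D′ ⟩
      length D′                                ∎
      where open ≤-Reasoning

  hubs-plus-minimum : ∃[ D ] (Optimal D × MinusHubsFeasible D)
  hubs-plus-minimum with minimum-minRep
  ... | S* , S*-unique , S*-feasible , S*-minimum = D , (feasible S*-unique , optimal) , minus-hubs
    where
    open HubsAndRepresentatives S* S*-feasible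

    optimal : ∀ D′ → Feasible D′ → length D ≤ length D′
    optimal D′ D′-feasible = begin
      length D      ≡⟨ D-length ⟩
      4 + length S* ≤⟨ +-monoʳ-≤ 4 (S*-minimum S S-feasible) ⟩
      4 + length S  ≤⟨ S-small ⟩
      length D′     ∎
      where
      open ≤-Reasoning
      open LowerBound D′ D′-feasible

-- The theorem.
claim3 : (kX sX kY sY : ℕ) → 1 ≤ sX → 1 ≤ sY →
         (E : Fin kX → Fin sX → Fin kY → Fin sY → Bool) →
         ∃[ D ] (Construction.Optimal kX sX kY sY E D
                 × Construction.MinusHubsFeasible kX sX kY sY E D)
claim3 kX sX kY sY _ _ E = Reduction.hubs-plus-minimum kX sX kY sY E
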